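{- For any finite simple undirected graph $G$, $\text{2- }\eta_{P}(G)\leq \theta(G)-\tau(G)+\mathrm{c}(G)$.
   Context: $P(G)$ is the parity Laplacian of $G$: the $\mathbb{F}_2$-matrix obtained by reducing the Laplacian $L(G)=D(G)-A(G)$ (equivalently $D(G)+A(G)$) modulo $2$, so its diagonal entries are the degrees mod 2 and off-diagonal entries are the adjacency entries. $\text{2- }\eta_{P}(G)$ is the dimension of the kernel of $P(G)$ over $\mathbb{F}_2$. $\mathrm{c}(G)$ is the number of connected components; $\theta(G)=\mathrm{e}(G)-\mathrm{v}(G)+\mathrm{c}(G)$ is the circuit rank (dimension over $\mathbb{F}_2$ of the cycle space of edge sets in which every vertex has even degree). A cycle is odd if it has an odd number of edges; two cycles are disjoint if they share no edge; $\tau(G)$ is the maximum cardinality of a set of pairwise disjoint odd cycles of $G$. -}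

module Defs where

open import Data.Nat using (ℕ; zero; suc; _+_; _≤_; _<_)
open import Data.Bool using (Bool; true; false; _xor_; _∧_; if_then_else_)
open import Data.Fin using (Fin; toℕ; _≟_)
open import Data.List using (List; []; _∷_; length; map; foldr; allFin)
open import Data.Nat.ListAction using (sum)
open import Data.List.Relation.Unary.Unique.Propositional using (Unique)
open import Data.Product using (_×_; Σ; _,_)
open import Data.Sum using (_⊎_)
open import Relation.Binary.PropositionalEquality using (_≡_; _≢_)
open import Relation.Nullary using (¬_; yes; no)
open import Relation.Nullary.Decidable using (⌊_⌋)
open import Function.Bundles using (_⇔_)
open import Function.Definitions using (Surjective)

record Graph : Set where
  field
    n      : ℕ
    adj    : Fin n → Fin n → Bool
    sym    : ∀ i j → adj i j ≡ adj j i
    irrefl : ∀ i → adj i i ≡ false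
open Graph public

bit : Bool → ℕ
bit true  = 1
bit false = 0

countFin : (m : ℕ) → (Fin m → Bool) → ℕ
countFin m p = sum (map (λ i → bit (p i)) (allFin m))

v : Graph → ℕ
v G = n G

-- number of edges: unordered pairs {i,j} (counted once via toℕ i < toℕ j)
ltB : ∀ {m} → Fin m → Fin m → Bool
ltB i j = ⌊ Data.Nat._<?_ (toℕ i) (toℕ j) ⌋

e : Graph → ℕ
e G = sum (map (λ i → countFin (n G) (λ j → ltB i j ∧ adj G i j)) (allFin (n G)))

deg : (G : Graph) → Fin (n G) → ℕ
deg G i = countFin (n G) (adj G i)

oddB : ℕ → Bool
oddB zero = false
oddB (suc zero) = true
oddB (suc (suc k)) = oddB k

data Reach (G : Graph) : Fin (n G) → Fin (n G) → Set where
  here : ∀ {i} → Reach G i i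
  step : ∀ {i j k} → adj G i j ≡ true → Reach G j k → Reach G i k

HasComponents : Graph → ℕ → Set
HasComponents G c =
  Σ (Fin (n G) → Fin c) λ comp →
    Surjective _≡_ _≡_ comp ×
    (∀ i j → (comp i ≡ comp j) ⇔ Reach G i j)

xsum : ∀ {m} → (Fin m → Bool) → Bool
xsum {m} f = foldr _xor_ false (map f (allFin m))

-- parity Laplacian P(G) = L(G) mod 2
P : (G : Graph) → Fin (n G) → Fin (n G) → Bool
P G i j with i ≟ j
... | yes _ = oddB (deg G i)
... | no  _ = adj G i j

mulP : (G : Graph) → (Fin (n G) → Bool) → Fin (n G) → Bool
mulP G x i = xsum (λ j → P G i j ∧ x j)

InKernel : (G : Graph) → (Fin (n G) → Bool) → Set
InKernel G x = ∀ i → mulP G x i ≡ false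

LinIndep : ∀ {m k} → (Fin k → Fin m → Bool) → Set
LinIndep {m} {k} vs =
  (a : Fin k → Bool) →
  (∀ i → xsum (λ l → a l ∧ vs l i) ≡ false) →
  ∀ l → a l ≡ false

-- 2-η_P(G) ≥ k : there are k linearly independent vectors in ker P(G)
KernelDimAtLeast : Graph → ℕ → Set
KernelDimAtLeast G k =
  Σ (Fin k → Fin (n G) → Bool) λ vs → LinIndep vs × (∀ l → InKernel G (vs l))

data Consec {A : Set} : List A → A → A → Set where
  c-here  : ∀ {a b xs} → Consec (a ∷ b ∷ xs) a b
  c-there : ∀ {a xs x y} → Consec xs x y → Consec (a ∷ xs) x y

lastOr : {A : Set} → A → List A → A
lastOr d [] = d
lastOr d (x ∷ xs) = lastOr x xs

data CycStep {A : Set} : List A → A → A → Set where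
  cs-lin   : ∀ {xs x y} → Consec xs x y → CycStep xs x y
  cs-close : ∀ {x xs} → CycStep (x ∷ xs) (lastOr x xs) x

CycEdge : {A : Set} → List A → A → A → Set
CycEdge xs x y = CycStep xs x y ⊎ CycStep xs y x

record Cycle (G : Graph) : Set where
  field
    verts    : List (Fin (n G))
    long     : 3 ≤ length verts
    distinct : Unique verts
    edges    : ∀ {x y} → CycStep verts x y → adj G x y ≡ true
open Cycle public

-- number of edges of a cycle = number of vertices
OddCycle : {G : Graph} → Cycle G → Set
OddCycle C = oddB (length (verts C)) ≡ true

EdgeDisjoint : {G : Graph} → Cycle G → Cycle G → Set
EdgeDisjoint C D = ∀ x y → CycEdge (verts C) x y → ¬ CycEdge (verts D) x y

-- τ(G) ≥ t : G has t pairwise (edge-)disjoint odd cycles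
DisjointOddCycles : Graph → ℕ → Set
DisjointOddCycles G t =
  Σ (Fin t → Cycle G) λ Cs →
    (∀ a → OddCycle (Cs a)) × (∀ a b → a ≢ b → EdgeDisjoint (Cs a) (Cs b))

module Submission where

-- Exhibit η + τ + v vectors of F₂^E ⊕ F₂^c ⊕ F₂^c that are linearly independent on these
-- e + 2c coordinates. With δx the coboundary of a vertex function x
-- (δx(uw) = x u + x w) and a root chosen in each component, they are:
--   (δx, x at the roots, 0)              for x in a basis of ker P(G),
--   (edge set of C, 0, 0)                for each of the τ edge-disjoint odd cycles C,
--   (root-to-i walk mod 2, 0, [comp i])  for each vertex i.
-- Given a vanishing combination, apply the boundary ∂ to its edge part: since ∂δ = P(G), the kernel
-- part dies, the cycles die, and the walks leave Σ γᵢ (root i + i), which with the third block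
-- forces every γᵢ = 0. Pairing with an odd cycle then kills coboundaries and, by oddness and
-- edge-disjointness, isolates that cycle's coefficient. What is left is δX = 0 for a combination
-- X of kernel vectors, so X is constant on components, zero by the second block, and the kernel
-- coefficients vanish.

open import Defs hiding (sym)
open import Algebra.Bundles using (CommutativeRing)
open import Data.Bool using (Bool; true; false; not; _∧_; _xor_)
open import Data.Bool.Properties
  using (xor-assoc; xor-comm; xor-same; xor-identityʳ; ∧-comm; ∧-assoc; ∧-zeroʳ; ∧-identityʳ;
         ∧-distribˡ-xor; ¬-not; T-≡; xor-∧-commutativeRing)
  renaming (_≟_ to _≟𝔹_)
open import Algebra.Properties.CommutativeSemigroup
  (CommutativeRing.+-commutativeSemigroup xor-∧-commutativeRing) using (interchange)
open import Data.Fin using (Fin; zero; suc; toℕ; _≟_; _<_; _↑ˡ_; _↑ʳ_; punchIn; splitAt; join)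
open import Data.Fin.Properties using (any?; punchInᵢ≢i; join-splitAt; <-cmp)
open import Data.List using (List; []; _∷_; length; map; foldr; allFin; filter; _++_; concatMap)
open import Data.List.Properties using (map-tabulate; length-++; length-map; length-tabulate; map-cong)
open import Data.List.Membership.Propositional.Properties using (∈-++⁻; ∈-++⁺ˡ; ∈-++⁺ʳ; ∈-map⁺; ∈-filter⁺; ∈-allFin; ∈-concat⁺′)
open import Data.Nat.ListAction using (sum)
open import Data.List.Membership.Propositional using (_∈_)
open import Data.List.Relation.Unary.Any using (here; there)
import Data.Nat as ℕ
open import Data.Nat using (ℕ; zero; suc; _+_; _≤_; z≤n; s≤s)
open import Data.Nat.Properties using (m≤n⇒m≤1+n; +-comm; +-assoc)
open import Data.Product using (_×_; _,_; proj₁; proj₂) renaming (map to ×-map)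
open import Data.Sum using (_⊎_; inj₁; inj₂; [_,_]) renaming (map to ⊎-map)
open import Data.Vec.Functional using (insertAt) renaming (_++_ to _++ᵛ_)
open import Data.Vec.Functional.Properties using (insertAt-lookup; insertAt-punchIn; lookup-++ˡ; lookup-++ʳ)
open import Function using (_∘_; id)
open import Relation.Binary.PropositionalEquality hiding ([_])
open import Relation.Nullary using (yes; no; does; contradiction)
open import Relation.Binary.Definitions using (tri<; tri≈; tri>)
open import Function.Bundles using (Equivalence)
open import Relation.Nullary.Decidable using (T?; dec-true; dec-false; isYes≗does)
open ≡-Reasoning

xor-interchange : ∀ a b c d → (a xor b) xor (c xor d) ≡ (a xor c) xor (b xor d)
xor-interchange = interchange

xor-cancelᵐ : ∀ a b d → (a xor b) xor (b xor d) ≡ a xor d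
xor-cancelᵐ a b d = begin
  (a xor b) xor (b xor d)  ≡⟨ xor-assoc a b (b xor d) ⟩
  a xor (b xor (b xor d))  ≡⟨ cong (a xor_) (sym (xor-assoc b b d)) ⟩
  a xor ((b xor b) xor d)  ≡⟨ cong (λ z → a xor (z xor d)) (xor-same b) ⟩
  a xor d                  ∎

xor≡false⇒≡ : ∀ a b → a xor b ≡ false → a ≡ b
xor≡false⇒≡ false false _ = refl
xor≡false⇒≡ true  true  _ = refl

∧-swapˡ : ∀ a b d → a ∧ (b ∧ d) ≡ b ∧ (a ∧ d)
∧-swapˡ true  b d = refl
∧-swapˡ false b d = sym (∧-zeroʳ b)

∧-vanishing : ∀ b {d} → (b ≡ true → d ≡ false) → b ∧ d ≡ false
∧-vanishing true  h = h refl
∧-vanishing false _ = refl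

oddB-suc : ∀ m → oddB (suc m) ≡ not (oddB m)
oddB-suc zero          = refl
oddB-suc (suc zero)    = refl
oddB-suc (suc (suc m)) = oddB-suc m

xsumL : {A : Set} → List A → (A → Bool) → Bool
xsumL L f = foldr _xor_ false (map f L)

module _ {A : Set} where

  xsumL-cong : ∀ L {f g : A → Bool} → (∀ {x} → x ∈ L → f x ≡ g x) → xsumL L f ≡ xsumL L g
  xsumL-cong []      eq = refl
  xsumL-cong (x ∷ L) eq = cong₂ _xor_ (eq (here refl)) (xsumL-cong L (eq ∘ there))

  xsumL-zero : ∀ L {f : A → Bool} → (∀ {x} → x ∈ L → f x ≡ false) → xsumL L f ≡ false
  xsumL-zero []      _ = refl
  xsumL-zero (x ∷ L) z = cong₂ _xor_ (z (here refl)) (xsumL-zero L (z ∘ there))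

  xsumL-xor : ∀ L (f g : A → Bool) → xsumL L (λ x → f x xor g x) ≡ xsumL L f xor xsumL L g
  xsumL-xor []      f g = refl
  xsumL-xor (x ∷ L) f g = trans (cong ((f x xor g x) xor_) (xsumL-xor L f g))
                                (xor-interchange (f x) (g x) (xsumL L f) (xsumL L g))

  xsumL-∧ˡ : ∀ L b (f : A → Bool) → xsumL L (λ x → b ∧ f x) ≡ b ∧ xsumL L f
  xsumL-∧ˡ []      b f = sym (∧-zeroʳ b)
  xsumL-∧ˡ (x ∷ L) b f = trans (cong ((b ∧ f x) xor_) (xsumL-∧ˡ L b f))
                               (sym (∧-distribˡ-xor b (f x) (xsumL L f)))

  xsumL-map : ∀ {B : Set} (L : List B) (h : B → A) f → xsumL (map h L) f ≡ xsumL L (f ∘ h)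
  xsumL-map []      h f = refl
  xsumL-map (x ∷ L) h f = cong (f (h x) xor_) (xsumL-map L h f)

  xsumL-filter : ∀ L (p f : A → Bool) → xsumL (filter (T? ∘ p) L) f ≡ xsumL L (λ x → p x ∧ f x)
  xsumL-filter []      p f = refl
  xsumL-filter (x ∷ L) p f with p x
  ... | true  = cong (f x xor_) (xsumL-filter L p f)
  ... | false = xsumL-filter L p f

  xsumL-const : ∀ (L : List A) b → xsumL L (λ _ → b) ≡ b ∧ oddB (length L)
  xsumL-const []      b     = sym (∧-zeroʳ b)
  xsumL-const (x ∷ L) false = xsumL-const L false
  xsumL-const (x ∷ L) true  = trans (cong not (xsumL-const L true)) (sym (oddB-suc (length L)))

  -- over F₂ the off-diagonal terms of a symmetric double sum cancel in pairs
  xsumL-symmetric : ∀ L (m : A → A → Bool) → (∀ x y → m x y ≡ m y x) →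
                    xsumL L (λ x → xsumL L (m x)) ≡ xsumL L (λ x → m x x)
  xsumL-symmetric []      m m-sym = refl
  xsumL-symmetric (a ∷ L) m m-sym = begin
    (m a a xor xsumL L (m a)) xor xsumL L (λ x → m x a xor xsumL L (m x))
      ≡⟨ cong ((m a a xor xsumL L (m a)) xor_) (xsumL-xor L (λ x → m x a) (λ x → xsumL L (m x))) ⟩
    (m a a xor xsumL L (m a)) xor (xsumL L (λ x → m x a) xor xsumL L (λ x → xsumL L (m x)))
      ≡⟨ cong (λ z → (m a a xor xsumL L (m a)) xor (z xor xsumL L (λ x → xsumL L (m x))))
              (xsumL-cong L (λ {x} _ → m-sym x a)) ⟩
    (m a a xor xsumL L (m a)) xor (xsumL L (m a) xor xsumL L (λ x → xsumL L (m x)))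
      ≡⟨ xor-cancelᵐ (m a a) (xsumL L (m a)) _ ⟩
    m a a xor xsumL L (λ x → xsumL L (m x))
      ≡⟨ cong (m a a xor_) (xsumL-symmetric L m m-sym) ⟩
    m a a xor xsumL L (λ x → m x x)  ∎

xsumL-comm : ∀ {A B : Set} (L : List A) (M : List B) (g : A → B → Bool) →
             xsumL L (λ x → xsumL M (g x)) ≡ xsumL M (λ y → xsumL L (λ x → g x y))
xsumL-comm []      M g = sym (xsumL-zero M (λ _ → refl))
xsumL-comm (x ∷ L) M g = trans (cong (xsumL M (g x) xor_) (xsumL-comm L M g))
                               (sym (xsumL-xor M (g x) (λ y → xsumL L (λ x′ → g x′ y))))

xsum-cong : ∀ {k} {f g : Fin k → Bool} → (∀ i → f i ≡ g i) → xsum f ≡ xsum g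
xsum-cong {k} eq = xsumL-cong (allFin k) (λ {i} _ → eq i)

xsum-zero : ∀ {k} {f : Fin k → Bool} → (∀ i → f i ≡ false) → xsum f ≡ false
xsum-zero {k} z = xsumL-zero (allFin k) (λ {i} _ → z i)

xsum-suc : ∀ {k} (f : Fin (suc k) → Bool) → xsum f ≡ f zero xor xsum (f ∘ suc)
xsum-suc {k} f = cong (λ L → f zero xor foldr _xor_ false L)
                      (trans (map-tabulate suc f) (sym (map-tabulate id (f ∘ suc))))

xsum-split : ∀ m n (f : Fin (m + n) → Bool) →
             xsum f ≡ xsum (f ∘ (_↑ˡ n)) xor xsum (f ∘ (m ↑ʳ_))
xsum-split zero    n f = refl
xsum-split (suc m) n f = begin
  xsum f                                                               ≡⟨ xsum-suc f ⟩
  f zero xor xsum (f ∘ suc)                                            ≡⟨ cong (f zero xor_) (xsum-split m n (f ∘ suc)) ⟩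
  f zero xor (xsum (f ∘ suc ∘ (_↑ˡ n)) xor xsum (f ∘ suc ∘ (m ↑ʳ_)))  ≡⟨ sym (xor-assoc (f zero) _ _) ⟩
  (f zero xor xsum (f ∘ suc ∘ (_↑ˡ n))) xor xsum (f ∘ suc ∘ (m ↑ʳ_))  ≡⟨ cong (_xor xsum (f ∘ (suc m ↑ʳ_))) (sym (xsum-suc (f ∘ (_↑ˡ n)))) ⟩
  xsum (f ∘ (_↑ˡ n)) xor xsum (f ∘ (suc m ↑ʳ_))                        ∎

xsum-punchIn : ∀ {k} (f : Fin (suc k) → Bool) i → xsum f ≡ f i xor xsum (f ∘ punchIn i)
xsum-punchIn         f zero    = xsum-suc f
xsum-punchIn {suc k} f (suc i) = begin
  xsum f                                                   ≡⟨ xsum-suc f ⟩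
  f zero xor xsum (f ∘ suc)                                ≡⟨ cong (f zero xor_) (xsum-punchIn (f ∘ suc) i) ⟩
  f zero xor (f (suc i) xor xsum (f ∘ suc ∘ punchIn i))    ≡⟨ sym (xor-assoc (f zero) _ _) ⟩
  (f zero xor f (suc i)) xor xsum (f ∘ suc ∘ punchIn i)    ≡⟨ cong (_xor xsum (f ∘ suc ∘ punchIn i)) (xor-comm (f zero) (f (suc i))) ⟩
  (f (suc i) xor f zero) xor xsum (f ∘ suc ∘ punchIn i)    ≡⟨ xor-assoc (f (suc i)) (f zero) _ ⟩
  f (suc i) xor (f zero xor xsum (f ∘ suc ∘ punchIn i))    ≡⟨ cong (f (suc i) xor_) (sym (xsum-suc (f ∘ punchIn (suc i)))) ⟩
  f (suc i) xor xsum (f ∘ punchIn (suc i))                 ∎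

xsum-delta : ∀ {k} (f : Fin k → Bool) i → (∀ j → j ≢ i → f j ≡ false) → xsum f ≡ f i
xsum-delta {suc k} f i off = begin
  xsum f                          ≡⟨ xsum-punchIn f i ⟩
  f i xor xsum (f ∘ punchIn i)    ≡⟨ cong (f i xor_) (xsum-zero (λ j → off (punchIn i j) (punchInᵢ≢i i j))) ⟩
  f i xor false                   ≡⟨ xor-identityʳ (f i) ⟩
  f i                             ∎

lincomb : ∀ {k} {I : Set} → (Fin k → Bool) → (Fin k → I → Bool) → I → Bool
lincomb a vs i = xsum (λ l → a l ∧ vs l i)

lincomb-zeroʳ : ∀ {k} {I : Set} (a : Fin k → Bool) (vs : Fin k → I → Bool) i →
                (∀ l → vs l i ≡ false) → lincomb a vs i ≡ false
lincomb-zeroʳ a vs i z = xsum-zero (λ l → trans (cong (a l ∧_) (z l)) (∧-zeroʳ (a l)))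

lincomb-zeroˡ : ∀ {k} {I : Set} (a : Fin k → Bool) (vs : Fin k → I → Bool) i →
                (∀ l → a l ≡ false) → lincomb a vs i ≡ false
lincomb-zeroˡ a vs i z = xsum-zero (λ l → cong (_∧ vs l i) (z l))

lincomb-++ : ∀ {m n} {I : Set} (a : Fin (m + n) → Bool) (us : Fin m → I → Bool) (ws : Fin n → I → Bool) i →
             lincomb a (us ++ᵛ ws) i ≡ lincomb (a ∘ (_↑ˡ n)) us i xor lincomb (a ∘ (m ↑ʳ_)) ws i
lincomb-++ {m} {n} a us ws i = trans (xsum-split m n (λ l → a l ∧ (us ++ᵛ ws) l i))
  (cong₂ _xor_ (xsum-cong (λ l → cong (λ v → a (l ↑ˡ n) ∧ v i) (lookup-++ˡ us ws l)))
               (xsum-cong (λ l → cong (λ v → a (m ↑ʳ l) ∧ v i) (lookup-++ʳ us ws l))))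

xsumL-lincomb : ∀ {k} {I : Set} (L : List I) (a : Fin k → Bool) (vs : Fin k → I → Bool) →
                xsumL L (lincomb a vs) ≡ xsum (λ l → a l ∧ xsumL L (vs l))
xsumL-lincomb {k} L a vs = trans (xsumL-comm L (allFin k) (λ i l → a l ∧ vs l i))
                                 (xsum-cong (λ l → xsumL-∧ˡ L (a l) (vs l)))

↑-elim : ∀ m n {P : Fin (m + n) → Set} → (∀ i → P (i ↑ˡ n)) → (∀ j → P (m ↑ʳ j)) → ∀ l → P l
↑-elim m n {P} left right l = subst P (join-splitAt m n l) ([_,_] {C = P ∘ join m n} left right (splitAt m l))

IndependentOn : ∀ {k} {I : Set} → List I → (Fin k → I → Bool) → Set
IndependentOn cs vs = ∀ a → (∀ {i} → i ∈ cs → lincomb a vs i ≡ false) → ∀ l → a l ≡ false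

independentOn-∷ : ∀ {k} {I : Set} {c : I} {cs} (vs : Fin k → I → Bool) →
                  (∀ l → vs l c ≡ false) → IndependentOn (c ∷ cs) vs → IndependentOn cs vs
independentOn-∷ {c = c} vs zero-at-c ind a onCs = ind a λ
  { (here refl) → lincomb-zeroʳ a vs c zero-at-c
  ; (there i∈cs) → onCs i∈cs }

lincomb-insertAt : ∀ {k} {I : Set} (a : Fin k → Bool) (vs : Fin (suc k) → I → Bool) l₀ s i →
                   lincomb (insertAt a l₀ s) vs i ≡ (s ∧ vs l₀ i) xor lincomb a (vs ∘ punchIn l₀) i
lincomb-insertAt a vs l₀ s i =
  trans (xsum-punchIn (λ l → insertAt a l₀ s l ∧ vs l i) l₀)
        (cong₂ _xor_ (cong (_∧ vs l₀ i) (insertAt-lookup a l₀ s))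
                     (xsum-cong (λ m → cong (_∧ vs (punchIn l₀ m) i) (insertAt-punchIn a l₀ s m))))

-- Gaussian elimination of the coordinate c using the pivot vector l₀.
eliminate : ∀ {k} {I : Set} → (Fin (suc k) → I → Bool) → I → Fin (suc k) → Fin k → I → Bool
eliminate vs c l₀ m i = vs (punchIn l₀ m) i xor (vs (punchIn l₀ m) c ∧ vs l₀ i)

lincomb-eliminate : ∀ {k} {I : Set} (a : Fin k → Bool) (vs : Fin (suc k) → I → Bool) c l₀ i →
  lincomb a (eliminate vs c l₀) i ≡ lincomb a (vs ∘ punchIn l₀) i xor (lincomb a (vs ∘ punchIn l₀) c ∧ vs l₀ i)
lincomb-eliminate {k} a vs c l₀ i = begin
  xsum (λ m → a m ∧ (w m i xor (w m c ∧ vs l₀ i)))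
    ≡⟨ xsum-cong (λ m → ∧-distribˡ-xor (a m) (w m i) (w m c ∧ vs l₀ i)) ⟩
  xsum (λ m → (a m ∧ w m i) xor (a m ∧ (w m c ∧ vs l₀ i)))
    ≡⟨ xsumL-xor (allFin k) _ _ ⟩
  lincomb a w i xor xsum (λ m → a m ∧ (w m c ∧ vs l₀ i))
    ≡⟨ cong (lincomb a w i xor_) (xsum-cong (λ m → trans (sym (∧-assoc (a m) _ _)) (∧-comm _ (vs l₀ i)))) ⟩
  lincomb a w i xor xsum (λ m → vs l₀ i ∧ (a m ∧ w m c))
    ≡⟨ cong (lincomb a w i xor_) (trans (xsumL-∧ˡ (allFin k) (vs l₀ i) _) (∧-comm (vs l₀ i) _)) ⟩
  lincomb a w i xor (lincomb a w c ∧ vs l₀ i)  ∎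
  where w = vs ∘ punchIn l₀

eliminate-independentOn : ∀ {k} {I : Set} {c : I} {cs} (vs : Fin (suc k) → I → Bool) l₀ →
  vs l₀ c ≡ true → IndependentOn (c ∷ cs) vs → IndependentOn cs (eliminate vs c l₀)
eliminate-independentOn {c = c} vs l₀ pivot ind a onCs m =
  trans (sym (insertAt-punchIn a l₀ s m)) (ind (insertAt a l₀ s) onC∷Cs (punchIn l₀ m))
  where
  s = lincomb a (vs ∘ punchIn l₀) c
  lifted : ∀ i → lincomb (insertAt a l₀ s) vs i ≡ lincomb a (eliminate vs c l₀) i
  lifted i = trans (lincomb-insertAt a vs l₀ s i)
                   (trans (xor-comm (s ∧ vs l₀ i) _) (sym (lincomb-eliminate a vs c l₀ i)))
  onC∷Cs : ∀ {i} → i ∈ c ∷ _ → lincomb (insertAt a l₀ s) vs i ≡ false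
  onC∷Cs (here refl) = begin
    lincomb (insertAt a l₀ s) vs c     ≡⟨ lifted c ⟩
    lincomb a (eliminate vs c l₀) c    ≡⟨ lincomb-eliminate a vs c l₀ c ⟩
    s xor (s ∧ vs l₀ c)                ≡⟨ cong (λ z → s xor (s ∧ z)) pivot ⟩
    s xor (s ∧ true)                   ≡⟨ cong (s xor_) (∧-identityʳ s) ⟩
    s xor s                            ≡⟨ xor-same s ⟩
    false                              ∎
  onC∷Cs (there i∈cs) = trans (lifted _) (onCs i∈cs)

independentOn⇒≤length : ∀ {k} {I : Set} (cs : List I) (vs : Fin k → I → Bool) →
                        IndependentOn cs vs → k ≤ length cs
independentOn⇒≤length {zero}  cs       vs ind = z≤n
independentOn⇒≤length {suc k} []       vs ind = contradiction (ind (λ _ → true) (λ ()) zero) λ ()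
independentOn⇒≤length {suc k} (c ∷ cs) vs ind with any? (λ l → vs l c ≟𝔹 true)
... | yes (l₀ , pivot) = s≤s (independentOn⇒≤length cs (eliminate vs c l₀) (eliminate-independentOn vs l₀ pivot ind))
... | no noPivot       = m≤n⇒m≤1+n (independentOn⇒≤length cs vs
                           (independentOn-∷ vs (λ l → ¬-not (λ vl → noPivot (l , vl))) ind))

length-filter : ∀ {A : Set} (p : A → Bool) L → length (filter (T? ∘ p) L) ≡ sum (map (bit ∘ p) L)
length-filter p []      = refl
length-filter p (x ∷ L) with p x
... | true  = cong suc (length-filter p L)
... | false = length-filter p L

length-concatMap : ∀ {A B : Set} (f : A → List B) L → length (concatMap f L) ≡ sum (map (length ∘ f) L)
length-concatMap f []      = refl
length-concatMap f (x ∷ L) = trans (length-++ (f x)) (cong (length (f x) +_) (length-concatMap f L))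

_≡ᵇ_ : ∀ {m} → Fin m → Fin m → Bool
i ≡ᵇ j = does (i ≟ j)

≡ᵇ-≡ : ∀ {m} {i j : Fin m} → i ≡ j → (i ≡ᵇ j) ≡ true
≡ᵇ-≡ {i = i} {j} = dec-true (i ≟ j)

≡ᵇ-refl : ∀ {m} (i : Fin m) → (i ≡ᵇ i) ≡ true
≡ᵇ-refl i = ≡ᵇ-≡ {i = i} refl

≡ᵇ-≢ : ∀ {m} {i j : Fin m} → i ≢ j → (i ≡ᵇ j) ≡ false
≡ᵇ-≢ {i = i} {j} = dec-false (i ≟ j)

≡ᵇ⇒≡ : ∀ {m} (i j : Fin m) → (i ≡ᵇ j) ≡ true → i ≡ j
≡ᵇ⇒≡ i j h with i ≟ j
... | yes i≡j = i≡j
... | no  _   = contradiction h λ ()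

≡ᵇ-sym : ∀ {m} (i j : Fin m) → (i ≡ᵇ j) ≡ (j ≡ᵇ i)
≡ᵇ-sym i j with i ≟ j
... | yes refl = sym (≡ᵇ-refl i)
... | no  i≢j  = sym (≡ᵇ-≢ (i≢j ∘ sym))

xsum-pick : ∀ {k} (f : Fin k → Bool) q → xsum (λ j → f j ∧ (j ≡ᵇ q)) ≡ f q
xsum-pick f q = begin
  xsum (λ j → f j ∧ (j ≡ᵇ q))  ≡⟨ xsum-delta _ q (λ j j≢q → trans (cong (f j ∧_) (≡ᵇ-≢ j≢q)) (∧-zeroʳ (f j))) ⟩
  f q ∧ (q ≡ᵇ q)               ≡⟨ cong (f q ∧_) (≡ᵇ-refl q) ⟩
  f q ∧ true                   ≡⟨ ∧-identityʳ (f q) ⟩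
  f q                          ∎

xsum-differ-at : ∀ {k} (f g : Fin k → Bool) i → (∀ j → j ≢ i → f j ≡ g j) →
                 xsum f ≡ (f i xor g i) xor xsum g
xsum-differ-at {k} f g i same = begin
  xsum f                              ≡⟨ sym (xor-identityʳ (xsum f)) ⟩
  xsum f xor false                    ≡⟨ cong (xsum f xor_) (sym (xor-same (xsum g))) ⟩
  xsum f xor (xsum g xor xsum g)      ≡⟨ sym (xor-assoc (xsum f) (xsum g) (xsum g)) ⟩
  (xsum f xor xsum g) xor xsum g      ≡⟨ cong (_xor xsum g) (sym (xsumL-xor (allFin k) f g)) ⟩
  xsum (λ j → f j xor g j) xor xsum g ≡⟨ cong (_xor xsum g) (xsum-delta _ i (λ j j≢i → trans (cong (_xor g j) (same j j≢i)) (xor-same (g j)))) ⟩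
  (f i xor g i) xor xsum g            ∎

-- Vectors of F₂^E are modelled as functions on ordered pairs of vertices;
-- only their values on the arcs of edges matter.
δ : ∀ {A : Set} → (A → Bool) → A × A → Bool
δ x (u , w) = x u xor x w

Undirected : ∀ {A : Set} → (A × A → Bool) → Set
Undirected F = ∀ u w → F (u , w) ≡ F (w , u)

δ-undirected : ∀ {A : Set} (x : A → Bool) → Undirected (δ x)
δ-undirected x u w = xor-comm (x u) (x w)

lincomb-undirected : ∀ {k} {A : Set} (a : Fin k → Bool) (Fs : Fin k → A × A → Bool) →
                     (∀ l → Undirected (Fs l)) → Undirected (lincomb a Fs)
lincomb-undirected a Fs und u w = xsum-cong (λ l → cong (a l ∧_) (und l u w))

lincomb-δ : ∀ {k} {A : Set} (a : Fin k → Bool) (xs : Fin k → A → Bool) s →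
            lincomb a (δ ∘ xs) s ≡ δ (lincomb a xs) s
lincomb-δ {k} a xs (u , w) = trans (xsum-cong (λ l → ∧-distribˡ-xor (a l) (xs l u) (xs l w)))
                                   (xsumL-xor (allFin k) _ _)

sameEdge : ∀ {m} → Fin m × Fin m → Fin m × Fin m → Bool
sameEdge (p , q) (u , w) = ((p ≡ᵇ u) ∧ (q ≡ᵇ w)) xor ((p ≡ᵇ w) ∧ (q ≡ᵇ u))

chain : ∀ {m} → List (Fin m × Fin m) → Fin m × Fin m → Bool
chain L s = xsumL L (λ s′ → sameEdge s′ s)

sameEdge-sym : ∀ {m} (s s′ : Fin m × Fin m) → sameEdge s s′ ≡ sameEdge s′ s
sameEdge-sym (p , q) (u , w) =
  cong₂ _xor_ (cong₂ _∧_ (≡ᵇ-sym p u) (≡ᵇ-sym q w))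
              (trans (cong₂ _∧_ (≡ᵇ-sym p w) (≡ᵇ-sym q u)) (∧-comm (w ≡ᵇ p) (u ≡ᵇ q)))

sameEdge-refl : ∀ {m} {p q : Fin m} → p ≢ q → sameEdge (p , q) (p , q) ≡ true
sameEdge-refl {p = p} {q} p≢q rewrite ≡ᵇ-refl p | ≡ᵇ-refl q | ≡ᵇ-≢ p≢q = refl

∧-xor-∧≡true : ∀ a b c d → (a ∧ b) xor (c ∧ d) ≡ true → (a ≡ true × b ≡ true) ⊎ (c ≡ true × d ≡ true)
∧-xor-∧≡true true  true  _     _     _ = inj₁ (refl , refl)
∧-xor-∧≡true true  false true  true  _ = inj₂ (refl , refl)
∧-xor-∧≡true false _     true  true  _ = inj₂ (refl , refl)
∧-xor-∧≡true true  false false _     ()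
∧-xor-∧≡true true  false true  false ()
∧-xor-∧≡true false _     false _     ()
∧-xor-∧≡true false _     true  false ()

sameEdge⇒ : ∀ {m} (p q u w : Fin m) → sameEdge (p , q) (u , w) ≡ true → (p ≡ u × q ≡ w) ⊎ (p ≡ w × q ≡ u)
sameEdge⇒ p q u w same = ⊎-map (×-map (≡ᵇ⇒≡ p u) (≡ᵇ⇒≡ q w)) (×-map (≡ᵇ⇒≡ p w) (≡ᵇ⇒≡ q u))
                               (∧-xor-∧≡true (p ≡ᵇ u) (q ≡ᵇ w) (p ≡ᵇ w) (q ≡ᵇ u) same)

sameEdge-undirected : ∀ {m} (s : Fin m × Fin m) → Undirected (sameEdge s)
sameEdge-undirected (p , q) u w = xor-comm ((p ≡ᵇ u) ∧ (q ≡ᵇ w)) ((p ≡ᵇ w) ∧ (q ≡ᵇ u))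

chain-undirected : ∀ {m} (L : List (Fin m × Fin m)) → Undirected (chain L)
chain-undirected L u w = xsumL-cong L (λ {s′} _ → sameEdge-undirected s′ u w)

chain-dual : ∀ {m} (L M : List (Fin m × Fin m)) → xsumL L (chain M) ≡ xsumL M (chain L)
chain-dual L M = trans (xsumL-comm L M (λ s s′ → sameEdge s′ s))
                       (xsumL-cong M (λ {s′} _ → xsumL-cong L (λ {s} _ → sameEdge-sym s′ s)))

chain-self : ∀ {m} (L : List (Fin m × Fin m)) → (∀ {p q} → (p , q) ∈ L → p ≢ q) →
             xsumL L (chain L) ≡ oddB (length L)
chain-self L proper = begin
  xsumL L (λ s → xsumL L (λ s′ → sameEdge s′ s))  ≡⟨ xsumL-symmetric L (λ s s′ → sameEdge s′ s) (λ s s′ → sameEdge-sym s′ s) ⟩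
  xsumL L (λ s → sameEdge s s)                    ≡⟨ xsumL-cong L (λ s∈L → sameEdge-refl (proper s∈L)) ⟩
  xsumL L (λ _ → true)                            ≡⟨ xsumL-const L true ⟩
  oddB (length L)                                 ∎

data Walk {A : Set} : A → A → List (A × A) → Set where
  []  : ∀ {a} → Walk a a []
  _∷_ : ∀ {b c L} a → Walk b c L → Walk a c ((a , b) ∷ L)

walk-++ : ∀ {A : Set} {a b c : A} {L M} → Walk a b L → Walk b c M → Walk a c (L ++ M)
walk-++ []      w′ = w′
walk-++ (a ∷ w) w′ = a ∷ walk-++ w w′

walk-δ : ∀ {A : Set} {a b : A} {L} (x : A → Bool) → Walk a b L → xsumL L (δ x) ≡ x a xor x b
walk-δ {a = a} x []        = sym (xor-same (x a))
walk-δ x (_∷_ {b} {c} a w) = trans (cong ((x a xor x b) xor_) (walk-δ x w)) (xor-cancelᵐ (x a) (x b) (x c))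

consecutivePairs : ∀ {A : Set} → List A → List (A × A)
consecutivePairs []           = []
consecutivePairs (x ∷ [])     = []
consecutivePairs (x ∷ y ∷ ys) = (x , y) ∷ consecutivePairs (y ∷ ys)

cyclicPairs : ∀ {A : Set} → List A → List (A × A)
cyclicPairs []       = []
cyclicPairs (x ∷ xs) = consecutivePairs (x ∷ xs) ++ (lastOr x xs , x) ∷ []

module _ {A : Set} where

  consecutivePairs-walk : ∀ (x : A) xs → Walk x (lastOr x xs) (consecutivePairs (x ∷ xs))
  consecutivePairs-walk x []       = []
  consecutivePairs-walk x (y ∷ ys) = x ∷ consecutivePairs-walk y ys

  cyclicPairs-δ : ∀ (L : List A) x → xsumL (cyclicPairs L) (δ x) ≡ false
  cyclicPairs-δ []       x = refl
  cyclicPairs-δ (y ∷ ys) x =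
    trans (walk-δ x (walk-++ (consecutivePairs-walk y ys) (lastOr y ys ∷ []))) (xor-same (x y))

  ∈-consecutivePairs : ∀ {L : List A} {p q} → (p , q) ∈ consecutivePairs L → Consec L p q
  ∈-consecutivePairs {x ∷ y ∷ ys} (here refl)   = c-here
  ∈-consecutivePairs {x ∷ y ∷ ys} (there p,q∈L) = c-there (∈-consecutivePairs p,q∈L)

  ∈-cyclicPairs : ∀ {L : List A} {p q} → (p , q) ∈ cyclicPairs L → CycStep L p q
  ∈-cyclicPairs {x ∷ xs} p,q∈L with ∈-++⁻ (consecutivePairs (x ∷ xs)) p,q∈L
  ... | inj₁ lin           = cs-lin (∈-consecutivePairs lin)
  ... | inj₂ (here refl)   = cs-close

  length-cyclicPairs : ∀ (L : List A) → length (cyclicPairs L) ≡ length L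
  length-cyclicPairs []       = refl
  length-cyclicPairs (x ∷ xs) = trans (length-++ (consecutivePairs (x ∷ xs)))
                                      (trans (cong (_+ 1) (length-consecutive x xs)) (+-comm (length xs) 1))
    where
    length-consecutive : ∀ (x : A) xs → length (consecutivePairs (x ∷ xs)) ≡ length xs
    length-consecutive x []       = refl
    length-consecutive x (y ∷ ys) = cong suc (length-consecutive y ys)

module _ (G : Graph) where

  Vertex : Set
  Vertex = Fin (n G)

  Arc : Set
  Arc = Vertex × Vertex

  neighbours : Vertex → List Vertex
  neighbours i = filter (T? ∘ adj G i) (allFin (n G))

  star : Vertex → List Arc
  star i = map (i ,_) (neighbours i)

  ∂ : (Arc → Bool) → Vertex → Bool
  ∂ F i = xsumL (star i) F

  ∂-xsum : ∀ F i → ∂ F i ≡ xsum (λ j → adj G i j ∧ F (i , j))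
  ∂-xsum F i = trans (xsumL-map (neighbours i) (i ,_) F) (xsumL-filter (allFin (n G)) (adj G i) (F ∘ (i ,_)))

  P-diagonal : ∀ i → P G i i ≡ oddB (deg G i)
  P-diagonal i with i ≟ i
  ... | yes _   = refl
  ... | no  i≢i = contradiction refl i≢i

  P-offDiagonal : ∀ {i j} → j ≢ i → P G i j ≡ adj G i j
  P-offDiagonal {i} {j} j≢i with i ≟ j
  ... | yes i≡j = contradiction (sym i≡j) j≢i
  ... | no  _   = refl

  mulP-split : ∀ x i → mulP G x i ≡ (oddB (deg G i) ∧ x i) xor xsum (λ j → adj G i j ∧ x j)
  mulP-split x i = begin
    xsum (λ j → P G i j ∧ x j)
      ≡⟨ xsum-differ-at _ _ i (λ j j≢i → cong (_∧ x j) (P-offDiagonal j≢i)) ⟩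
    ((P G i i ∧ x i) xor (adj G i i ∧ x i)) xor xsum (λ j → adj G i j ∧ x j)
      ≡⟨ cong (λ z → ((P G i i ∧ x i) xor (z ∧ x i)) xor xsum (λ j → adj G i j ∧ x j)) (irrefl G i) ⟩
    ((P G i i ∧ x i) xor false) xor xsum (λ j → adj G i j ∧ x j)
      ≡⟨ cong (λ z → z xor xsum (λ j → adj G i j ∧ x j)) (trans (xor-identityʳ _) (cong (_∧ x i) (P-diagonal i))) ⟩
    (oddB (deg G i) ∧ x i) xor xsum (λ j → adj G i j ∧ x j)  ∎

  -- P(G) factors as ∂ ∘ δ: the diagonal degree term comes from the constant part x i of δ x.
  ∂δ≡mulP : ∀ x i → ∂ (δ x) i ≡ mulP G x i
  ∂δ≡mulP x i = begin
    xsumL (star i) (δ x)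
      ≡⟨ xsumL-map (neighbours i) (i ,_) (δ x) ⟩
    xsumL (neighbours i) (λ j → x i xor x j)
      ≡⟨ xsumL-xor (neighbours i) (λ _ → x i) x ⟩
    xsumL (neighbours i) (λ _ → x i) xor xsumL (neighbours i) x
      ≡⟨ cong₂ _xor_ (xsumL-const (neighbours i) (x i)) (xsumL-filter (allFin (n G)) (adj G i) x) ⟩
    (x i ∧ oddB (length (neighbours i))) xor xsum (λ j → adj G i j ∧ x j)
      ≡⟨ cong (λ d → (x i ∧ oddB d) xor xsum (λ j → adj G i j ∧ x j)) (length-filter (adj G i) (allFin (n G))) ⟩
    (x i ∧ oddB (deg G i)) xor xsum (λ j → adj G i j ∧ x j)
      ≡⟨ cong (_xor xsum (λ j → adj G i j ∧ x j)) (∧-comm (x i) (oddB (deg G i))) ⟩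
    (oddB (deg G i) ∧ x i) xor xsum (λ j → adj G i j ∧ x j)
      ≡⟨ sym (mulP-split x i) ⟩
    mulP G x i  ∎

  incident : ∀ {p q} i → adj G p q ≡ true → (i ≡ᵇ p) ∧ adj G i q ≡ (p ≡ᵇ i)
  incident {p} i pq with i ≟ p
  ... | yes refl = trans pq (sym (≡ᵇ-refl p))
  ... | no  i≢p  = sym (≡ᵇ-≢ (i≢p ∘ sym))

  chain-star : ∀ i {p q} → adj G p q ≡ true → chain (star i) (p , q) ≡ δ (_≡ᵇ i) (p , q)
  chain-star i {p} {q} pq = begin
    chain (star i) (p , q)
      ≡⟨ ∂-xsum (λ s′ → sameEdge s′ (p , q)) i ⟩
    xsum (λ j → adj G i j ∧ (((i ≡ᵇ p) ∧ (j ≡ᵇ q)) xor ((i ≡ᵇ q) ∧ (j ≡ᵇ p))))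
      ≡⟨ xsum-cong (λ j → trans (∧-distribˡ-xor (adj G i j) ((i ≡ᵇ p) ∧ (j ≡ᵇ q)) ((i ≡ᵇ q) ∧ (j ≡ᵇ p)))
                                (cong₂ _xor_ (∧-swapˡ (adj G i j) (i ≡ᵇ p) (j ≡ᵇ q))
                                             (∧-swapˡ (adj G i j) (i ≡ᵇ q) (j ≡ᵇ p)))) ⟩
    xsum (λ j → ((i ≡ᵇ p) ∧ (adj G i j ∧ (j ≡ᵇ q))) xor ((i ≡ᵇ q) ∧ (adj G i j ∧ (j ≡ᵇ p))))
      ≡⟨ xsumL-xor (allFin (n G)) _ _ ⟩
    xsum (λ j → (i ≡ᵇ p) ∧ (adj G i j ∧ (j ≡ᵇ q))) xor xsum (λ j → (i ≡ᵇ q) ∧ (adj G i j ∧ (j ≡ᵇ p)))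
      ≡⟨ cong₂ _xor_ (xsumL-∧ˡ (allFin (n G)) (i ≡ᵇ p) _) (xsumL-∧ˡ (allFin (n G)) (i ≡ᵇ q) _) ⟩
    ((i ≡ᵇ p) ∧ xsum (λ j → adj G i j ∧ (j ≡ᵇ q))) xor ((i ≡ᵇ q) ∧ xsum (λ j → adj G i j ∧ (j ≡ᵇ p)))
      ≡⟨ cong₂ _xor_ (cong ((i ≡ᵇ p) ∧_) (xsum-pick (adj G i) q)) (cong ((i ≡ᵇ q) ∧_) (xsum-pick (adj G i) p)) ⟩
    ((i ≡ᵇ p) ∧ adj G i q) xor ((i ≡ᵇ q) ∧ adj G i p)
      ≡⟨ cong₂ _xor_ (incident i pq) (incident i (trans (Graph.sym G q p) pq)) ⟩
    (p ≡ᵇ i) xor (q ≡ᵇ i)  ∎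

  AllEdges : List Arc → Set
  AllEdges L = ∀ {p q} → (p , q) ∈ L → adj G p q ≡ true

  -- ∂ and δ are adjoint for the pairing xsumL.
  ∂-chain : ∀ L → AllEdges L → ∀ i → ∂ (chain L) i ≡ xsumL L (δ (_≡ᵇ i))
  ∂-chain L edges i = trans (chain-dual (star i) L) (xsumL-cong L (λ p,q∈L → chain-star i (edges p,q∈L)))

  VanishesOnEdges : (Arc → Bool) → Set
  VanishesOnEdges F = ∀ {u w} → adj G u w ≡ true → F (u , w) ≡ false

  ∂-vanishing : ∀ {F} → VanishesOnEdges F → ∀ i → ∂ F i ≡ false
  ∂-vanishing z i = trans (∂-xsum _ i) (xsum-zero (λ j → ∧-vanishing (adj G i j) z))

  xsumL-vanishing : ∀ {F} L → VanishesOnEdges F → AllEdges L → xsumL L F ≡ false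
  xsumL-vanishing L z edges = xsumL-zero L (λ p,q∈L → z (edges p,q∈L))

  reachArcs : ∀ {a b} → Reach G a b → List Arc
  reachArcs here              = []
  reachArcs (step {i} {j} _ r) = (i , j) ∷ reachArcs r

  reachArcs-walk : ∀ {a b} (r : Reach G a b) → Walk a b (reachArcs r)
  reachArcs-walk here             = []
  reachArcs-walk (step {i} _ r)   = i ∷ reachArcs-walk r

  reachArcs-edges : ∀ {a b} (r : Reach G a b) → AllEdges (reachArcs r)
  reachArcs-edges (step ij r) (here refl)   = ij
  reachArcs-edges (step ij r) (there p,q∈r) = reachArcs-edges r p,q∈r

  reach-invariant : (X : Vertex → Bool) → (∀ {u w} → adj G u w ≡ true → X u ≡ X w) →
                    ∀ {a b} → Reach G a b → X a ≡ X b
  reach-invariant X inv here         = refl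
  reach-invariant X inv (step ij r)  = trans (inv ij) (reach-invariant X inv r)

  arcs : Cycle G → List Arc
  arcs C = cyclicPairs (verts C)

  arcs-edges : (C : Cycle G) → AllEdges (arcs C)
  arcs-edges C p,q∈C = edges C (∈-cyclicPairs p,q∈C)

  edge-proper : ∀ {p q} → adj G p q ≡ true → p ≢ q
  edge-proper {p} pq refl = contradiction (trans (sym pq) (irrefl G p)) λ ()

  ∂-cycle : (C : Cycle G) → ∀ i → ∂ (chain (arcs C)) i ≡ false
  ∂-cycle C i = trans (∂-chain (arcs C) (arcs-edges C) i) (cyclicPairs-δ (verts C) (_≡ᵇ i))

  oddCycle-self : (C : Cycle G) → OddCycle C → xsumL (arcs C) (chain (arcs C)) ≡ true
  oddCycle-self C odd = begin
    xsumL (arcs C) (chain (arcs C))  ≡⟨ chain-self (arcs C) (edge-proper ∘ arcs-edges C) ⟩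
    oddB (length (arcs C))           ≡⟨ cong oddB (length-cyclicPairs (verts C)) ⟩
    oddB (length (verts C))          ≡⟨ odd ⟩
    true                             ∎

  disjointCycles : (C D : Cycle G) → EdgeDisjoint C D → xsumL (arcs D) (chain (arcs C)) ≡ false
  disjointCycles C D disjoint = xsumL-zero (arcs D) λ u,w∈D → xsumL-zero (arcs C) λ p,q∈C →
    ¬-not (shared (∈-cyclicPairs p,q∈C) (∈-cyclicPairs u,w∈D))
    where
    shared : ∀ {p q u w} → CycStep (verts C) p q → CycStep (verts D) u w → sameEdge (p , q) (u , w) ≢ true
    shared {p} {q} {u} {w} pq uw same with sameEdge⇒ p q u w same
    ... | inj₁ (refl , refl) = disjoint _ _ (inj₁ pq) (inj₁ uw)
    ... | inj₂ (refl , refl) = disjoint _ _ (inj₂ pq) (inj₁ uw)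

  isEdgeFrom : Vertex → Vertex → Bool
  isEdgeFrom u w = ltB u w ∧ adj G u w

  edgesFrom : Vertex → List Arc
  edgesFrom u = map (u ,_) (filter (T? ∘ isEdgeFrom u) (allFin (n G)))

  edgeList : List Arc
  edgeList = concatMap edgesFrom (allFin (n G))

  length-edgeList : length edgeList ≡ e G
  length-edgeList = trans (length-concatMap edgesFrom (allFin (n G)))
    (cong sum (map-cong (λ u → trans (length-map (u ,_) (filter (T? ∘ isEdgeFrom u) (allFin (n G)))) (length-filter (isEdgeFrom u) (allFin (n G)))) (allFin (n G))))

  ∈-edgeList : ∀ {u w} → u < w → adj G u w ≡ true → (u , w) ∈ edgeList
  ∈-edgeList {u} {w} u<w uw =
    ∈-concat⁺′ (∈-map⁺ (u ,_) (∈-filter⁺ (T? ∘ isEdgeFrom u) (∈-allFin w) (Equivalence.from T-≡ forward)))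
               (∈-map⁺ edgesFrom (∈-allFin u))
    where
    forward : isEdgeFrom u w ≡ true
    forward = cong₂ _∧_ (trans (isYes≗does (toℕ u ℕ.<? toℕ w)) (dec-true (toℕ u ℕ.<? toℕ w) u<w)) uw

  vanishesOnEdges-fromEdgeList : ∀ {F} → Undirected F → (∀ {u w} → (u , w) ∈ edgeList → F (u , w) ≡ false) →
                    VanishesOnEdges F
  vanishesOnEdges-fromEdgeList {F} und onList {u} {w} uw with <-cmp u w
  ... | tri< u<w _ _ = onList (∈-edgeList u<w uw)
  ... | tri≈ _ u≡w _ = contradiction u≡w (edge-proper uw)
  ... | tri> _ _ w<u = trans (und u w) (onList (∈-edgeList w<u (trans (Graph.sym G w u) uw)))

module Components (G : Graph) {c : ℕ} (hc : HasComponents G c) where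

  comp : Vertex G → Fin c
  comp = proj₁ hc

  rep : Fin c → Vertex G
  rep j = proj₁ (proj₁ (proj₂ hc) j)

  comp-rep : ∀ j → comp (rep j) ≡ j
  comp-rep j = proj₂ (proj₁ (proj₂ hc) j) refl

  root : Vertex G → Vertex G
  root i = rep (comp i)

  path : ∀ i → Reach G (root i) i
  path i = Equivalence.to (proj₂ (proj₂ hc) (root i) i) (comp-rep (comp i))

  pathChain : Vertex G → Arc G → Bool
  pathChain i = chain (reachArcs G (path i))

  ∂-pathChain : ∀ i m → ∂ G (pathChain i) m ≡ (root i ≡ᵇ m) xor (i ≡ᵇ m)
  ∂-pathChain i m = trans (∂-chain G _ (reachArcs-edges G (path i)) m) (walk-δ (_≡ᵇ m) (reachArcs-walk G (path i)))

  root-≡ᵇ : ∀ i m → (root i ≡ᵇ m) ≡ (root m ≡ᵇ m) ∧ (comp i ≡ᵇ comp m)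
  root-≡ᵇ i m with root i ≟ m
  ... | yes refl = sym (cong₂ _∧_ (≡ᵇ-≡ (cong rep (comp-rep (comp i)))) (≡ᵇ-≡ (sym (comp-rep (comp i)))))
  ... | no root≢m with root m ≟ m | comp i ≟ comp m
  ...   | yes root-m | yes same = contradiction (trans (cong rep same) root-m) root≢m
  ...   | yes _      | no  _    = refl
  ...   | no  _      | _        = refl

  ∂-lincomb-pathChain : ∀ (γ : Vertex G → Bool) m →
    ∂ G (lincomb γ pathChain) m ≡ ((root m ≡ᵇ m) ∧ xsum (λ i → γ i ∧ (comp i ≡ᵇ comp m))) xor γ m
  ∂-lincomb-pathChain γ m = begin
    ∂ G (lincomb γ pathChain) m
      ≡⟨ xsumL-lincomb (star G m) γ pathChain ⟩
    xsum (λ i → γ i ∧ ∂ G (pathChain i) m)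
      ≡⟨ xsum-cong (λ i → trans (cong (γ i ∧_) (∂-pathChain i m)) (∧-distribˡ-xor (γ i) _ _)) ⟩
    xsum (λ i → (γ i ∧ (root i ≡ᵇ m)) xor (γ i ∧ (i ≡ᵇ m)))
      ≡⟨ xsumL-xor (allFin (n G)) _ _ ⟩
    xsum (λ i → γ i ∧ (root i ≡ᵇ m)) xor xsum (λ i → γ i ∧ (i ≡ᵇ m))
      ≡⟨ cong₂ _xor_ (xsum-cong (λ i → trans (cong (γ i ∧_) (root-≡ᵇ i m)) (∧-swapˡ (γ i) (root m ≡ᵇ m) (comp i ≡ᵇ comp m)))) (xsum-pick γ m) ⟩
    xsum (λ i → (root m ≡ᵇ m) ∧ (γ i ∧ (comp i ≡ᵇ comp m))) xor γ m
      ≡⟨ cong (_xor γ m) (xsumL-∧ˡ (allFin (n G)) (root m ≡ᵇ m) _) ⟩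
    ((root m ≡ᵇ m) ∧ xsum (λ i → γ i ∧ (comp i ≡ᵇ comp m))) xor γ m  ∎

  pathChains-independent : ∀ (γ : Vertex G → Bool) →
    (∀ m → ∂ G (lincomb γ pathChain) m ≡ false) →
    (∀ j → xsum (λ i → γ i ∧ (comp i ≡ᵇ j)) ≡ false) →
    ∀ m → γ m ≡ false
  pathChains-independent γ closed fibres m = begin
    γ m
      ≡⟨ cong (_xor γ m) (sym (trans (cong (root m ≡ᵇ m ∧_) (fibres (comp m))) (∧-zeroʳ _))) ⟩
    ((root m ≡ᵇ m) ∧ xsum (λ i → γ i ∧ (comp i ≡ᵇ comp m))) xor γ m
      ≡⟨ sym (∂-lincomb-pathChain γ m) ⟩
    ∂ G (lincomb γ pathChain) m
      ≡⟨ closed m ⟩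
    false  ∎

  vanishing-from-roots : (X : Vertex G → Bool) → (∀ {u w} → adj G u w ≡ true → X u ≡ X w) →
                         (∀ j → X (rep j) ≡ false) → ∀ m → X m ≡ false
  vanishing-from-roots X inv atRoots m = trans (sym (reach-invariant G X inv (path m))) (atRoots (comp m))

module Construction (G : Graph) {c k t : ℕ}
  (hc : HasComponents G c) (hk : KernelDimAtLeast G k) (ht : DisjointOddCycles G t) where

  open Components G hc

  kernel : Fin k → Vertex G → Bool
  kernel = proj₁ hk

  cycles : Fin t → Cycle G
  cycles = proj₁ ht

  cycleChain : Fin t → Arc G → Bool
  cycleChain a = chain (arcs G (cycles a))

  Coord : Set
  Coord = Arc G ⊎ (Fin c ⊎ Fin c)

  coords : List Coord
  coords = map inj₁ (edgeList G) ++ map (inj₂ ∘ inj₁) (allFin c) ++ map (inj₂ ∘ inj₂) (allFin c)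

  length-coords : length coords ≡ e G + c + c
  length-coords = begin
    length coords
      ≡⟨ length-++ (map inj₁ (edgeList G)) ⟩
    length (map inj₁ (edgeList G)) + length (map (inj₂ ∘ inj₁) (allFin c) ++ map (inj₂ ∘ inj₂) (allFin c))
      ≡⟨ cong (length (map inj₁ (edgeList G)) +_) (length-++ (map (inj₂ ∘ inj₁) (allFin c))) ⟩
    length (map inj₁ (edgeList G)) + (length (map (inj₂ ∘ inj₁) (allFin c)) + length (map (inj₂ ∘ inj₂) (allFin c)))
      ≡⟨ cong₂ _+_ (trans (length-map inj₁ (edgeList G)) (length-edgeList G))
                   (cong₂ _+_ (trans (length-map (inj₂ ∘ inj₁) (allFin c)) (length-tabulate {n = c} id))
                              (trans (length-map (inj₂ ∘ inj₂) (allFin c)) (length-tabulate {n = c} id))) ⟩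
    e G + (c + c)
      ≡⟨ sym (+-assoc (e G) c c) ⟩
    e G + c + c  ∎

  ⟦_,_,_⟧ : (Arc G → Bool) → (Fin c → Bool) → (Fin c → Bool) → Coord → Bool
  ⟦ F , y , z ⟧ (inj₁ s)         = F s
  ⟦ F , y , z ⟧ (inj₂ (inj₁ j)) = y j
  ⟦ F , y , z ⟧ (inj₂ (inj₂ j)) = z j

  kernelVec : Fin k → Coord → Bool
  kernelVec l = ⟦ δ (kernel l) , kernel l ∘ rep , (λ _ → false) ⟧

  cycleVec : Fin t → Coord → Bool
  cycleVec a = ⟦ cycleChain a , (λ _ → false) , (λ _ → false) ⟧

  pathVec : Vertex G → Coord → Bool
  pathVec i = ⟦ pathChain i , (λ _ → false) , (comp i ≡ᵇ_) ⟧

  vectors : Fin (k + t + n G) → Coord → Bool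
  vectors = (kernelVec ++ᵛ cycleVec) ++ᵛ pathVec

  module _ (a : Fin (k + t + n G) → Bool) (onCoords : ∀ {ι} → ι ∈ coords → lincomb a vectors ι ≡ false) where

    α : Fin k → Bool
    α l = a ((l ↑ˡ t) ↑ˡ n G)

    β : Fin t → Bool
    β l = a ((k ↑ʳ l) ↑ˡ n G)

    γ : Vertex G → Bool
    γ i = a ((k + t) ↑ʳ i)

    Fα Fβ Fγ : Arc G → Bool
    Fα = lincomb α (δ ∘ kernel)
    Fβ = lincomb β cycleChain
    Fγ = lincomb γ pathChain

    split : ∀ ι → lincomb a vectors ι ≡ lincomb α kernelVec ι xor (lincomb β cycleVec ι xor lincomb γ pathVec ι)
    split ι = begin
      lincomb a vectors ι
        ≡⟨ lincomb-++ a (kernelVec ++ᵛ cycleVec) pathVec ι ⟩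
      lincomb (a ∘ (_↑ˡ n G)) (kernelVec ++ᵛ cycleVec) ι xor lincomb γ pathVec ι
        ≡⟨ cong (_xor lincomb γ pathVec ι) (lincomb-++ (a ∘ (_↑ˡ n G)) kernelVec cycleVec ι) ⟩
      (lincomb α kernelVec ι xor lincomb β cycleVec ι) xor lincomb γ pathVec ι
        ≡⟨ xor-assoc (lincomb α kernelVec ι) _ _ ⟩
      lincomb α kernelVec ι xor (lincomb β cycleVec ι xor lincomb γ pathVec ι)  ∎

    split-vanishes : ∀ {ι} → ι ∈ coords →
                lincomb α kernelVec ι xor (lincomb β cycleVec ι xor lincomb γ pathVec ι) ≡ false
    split-vanishes {ι} ι∈coords = trans (sym (split ι)) (onCoords ι∈coords)

    F : Arc G → Bool
    F s = Fα s xor (Fβ s xor Fγ s)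

    xsumL-F : ∀ L → xsumL L F ≡ xsumL L Fα xor (xsumL L Fβ xor xsumL L Fγ)
    xsumL-F L = trans (xsumL-xor L Fα _) (cong (xsumL L Fα xor_) (xsumL-xor L Fβ Fγ))

    F-vanishes : VanishesOnEdges G F
    F-vanishes = vanishesOnEdges-fromEdgeList G undirected (λ s∈E → split-vanishes (∈-++⁺ˡ (∈-map⁺ inj₁ s∈E)))
      where
      undirected : Undirected F
      undirected u w = cong₂ _xor_ (lincomb-undirected α (δ ∘ kernel) (δ-undirected ∘ kernel) u w)
                         (cong₂ _xor_ (lincomb-undirected β cycleChain (λ l → chain-undirected (arcs G (cycles l))) u w)
                                      (lincomb-undirected γ pathChain (λ i → chain-undirected (reachArcs G (path i))) u w))

    onRoots : ∀ j → lincomb α kernel (rep j) ≡ false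
    onRoots j = trans (sym (trans (cong (lincomb α kernel (rep j) xor_)
                                        (cong₂ _xor_ (lincomb-zeroʳ β cycleVec ι (λ _ → refl))
                                                     (lincomb-zeroʳ γ pathVec ι (λ _ → refl))))
                                  (xor-identityʳ _)))
                      (split-vanishes (∈-++⁺ʳ (map inj₁ (edgeList G)) (∈-++⁺ˡ (∈-map⁺ (inj₂ ∘ inj₁) (∈-allFin j)))))
      where ι = inj₂ (inj₁ j)

    onComponents : ∀ j → xsum (λ i → γ i ∧ (comp i ≡ᵇ j)) ≡ false
    onComponents j = trans (sym (cong₂ _xor_ (lincomb-zeroʳ α kernelVec ι (λ _ → refl))
                                             (cong (_xor lincomb γ pathVec ι) (lincomb-zeroʳ β cycleVec ι (λ _ → refl)))))
                           (split-vanishes (∈-++⁺ʳ (map inj₁ (edgeList G))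
                                        (∈-++⁺ʳ (map (inj₂ ∘ inj₁) (allFin c)) (∈-map⁺ (inj₂ ∘ inj₂) (∈-allFin j)))))
      where ι = inj₂ (inj₂ j)

    ∂Fα : ∀ m → ∂ G Fα m ≡ false
    ∂Fα m = trans (xsumL-lincomb (star G m) α (δ ∘ kernel))
                  (xsum-zero (λ l → trans (cong (α l ∧_) (trans (∂δ≡mulP G (kernel l) m) (proj₂ (proj₂ hk) l m)))
                                          (∧-zeroʳ (α l))))

    ∂Fβ : ∀ m → ∂ G Fβ m ≡ false
    ∂Fβ m = trans (xsumL-lincomb (star G m) β cycleChain)
                  (xsum-zero (λ l → trans (cong (β l ∧_) (∂-cycle G (cycles l) m)) (∧-zeroʳ (β l))))

    γ-zero : ∀ i → γ i ≡ false
    γ-zero = pathChains-independent γ ∂Fγ onComponents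
      where
      ∂Fγ : ∀ m → ∂ G Fγ m ≡ false
      ∂Fγ m = begin
        ∂ G Fγ m                                       ≡⟨ cong₂ (λ x y → x xor (y xor ∂ G Fγ m)) (∂Fα m) (∂Fβ m) ⟨
        ∂ G Fα m xor (∂ G Fβ m xor ∂ G Fγ m)           ≡⟨ xsumL-F (star G m) ⟨
        ∂ G F m                                        ≡⟨ ∂-vanishing G F-vanishes m ⟩
        false                                          ∎

    β-zero : ∀ b → β b ≡ false
    β-zero b = begin
      β b                                                        ≡⟨ trans (xsum-delta _ b off) self ⟨
      xsum (λ l → β l ∧ xsumL C (cycleChain l))                  ≡⟨ xsumL-lincomb C β cycleChain ⟨
      xsumL C Fβ                                                 ≡⟨ trans (cong₂ (λ x y → x xor (xsumL C Fβ xor y)) Cα Cγ) (xor-identityʳ _) ⟨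
      xsumL C Fα xor (xsumL C Fβ xor xsumL C Fγ)                 ≡⟨ xsumL-F C ⟨
      xsumL C F                                                  ≡⟨ xsumL-vanishing G C F-vanishes (arcs-edges G (cycles b)) ⟩
      false                                                      ∎
      where
      C = arcs G (cycles b)
      Cα : xsumL C Fα ≡ false
      Cα = trans (xsumL-lincomb C α (δ ∘ kernel))
                 (xsum-zero (λ l → trans (cong (α l ∧_) (cyclicPairs-δ (verts (cycles b)) (kernel l))) (∧-zeroʳ (α l))))
      Cγ : xsumL C Fγ ≡ false
      Cγ = xsumL-zero C (λ {s} _ → lincomb-zeroˡ γ pathChain s γ-zero)
      self : β b ∧ xsumL C (cycleChain b) ≡ β b
      self = trans (cong (β b ∧_) (oddCycle-self G (cycles b) (proj₁ (proj₂ ht) b))) (∧-identityʳ (β b))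
      off : ∀ l → l ≢ b → β l ∧ xsumL C (cycleChain l) ≡ false
      off l l≢b = trans (cong (β l ∧_) (disjointCycles G (cycles l) (cycles b) (proj₂ (proj₂ ht) l b l≢b))) (∧-zeroʳ (β l))

    α-zero : ∀ l → α l ≡ false
    α-zero = proj₁ (proj₂ hk) α (vanishing-from-roots X X-invariant onRoots)
      where
      X : Vertex G → Bool
      X = lincomb α kernel
      Fα-vanishes : VanishesOnEdges G Fα
      Fα-vanishes {u} {w} uw = begin
        Fα (u , w)                            ≡⟨ xor-identityʳ (Fα (u , w)) ⟨
        Fα (u , w) xor false                  ≡⟨ cong (Fα (u , w) xor_) (cong₂ _xor_ (Fβ-zero (u , w)) (Fγ-zero (u , w))) ⟨
        F (u , w)                             ≡⟨ F-vanishes uw ⟩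
        false                                 ∎
        where
        Fβ-zero : ∀ s → Fβ s ≡ false
        Fβ-zero s = lincomb-zeroˡ β cycleChain s β-zero
        Fγ-zero : ∀ s → Fγ s ≡ false
        Fγ-zero s = lincomb-zeroˡ γ pathChain s γ-zero
      X-invariant : ∀ {u w} → adj G u w ≡ true → X u ≡ X w
      X-invariant {u} {w} uw = xor≡false⇒≡ (X u) (X w) (trans (sym (lincomb-δ α kernel (u , w))) (Fα-vanishes uw))

    all-zero : ∀ l → a l ≡ false
    all-zero = ↑-elim (k + t) (n G) (↑-elim k t α-zero β-zero) γ-zero

  vectors-independent : IndependentOn coords vectors
  vectors-independent = all-zero

  bound : k + t + v G ≤ e G + c + c
  bound = subst (k + t + v G ≤_) length-coords (independentOn⇒≤length coords vectors vectors-independent)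

theorem5 : (G : Graph) (c k t : ℕ) →
    HasComponents G c → KernelDimAtLeast G k → DisjointOddCycles G t →
    k + t + v G ≤ e G + c + c
theorem5 G c k t hc hk ht = Construction.bound G hc hk ht
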